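{- Let $G_1=(V_1,E_1)$ and $G_2=(V_2,E_2)$ be finite simple graphs and let $G_1 \circledast G_2$ denote their tensor product. Then $$M_N(G_1 \circledast G_2) = M_N(G_1)\,M_N(G_2).$$
   Context: For a finite simple graph $G$, $\deg_G(v)$ is the degree of $v$, $N_G(v)$ the set of neighbours of $v$, $\delta_G(v) = \sum_{u \in N_G(v)} \deg_G(u)$, and the Neighbourhood Zagreb index is $M_N(G) = \sum_{v \in V(G)} \delta_G(v)^2$. The tensor product $G_1 \circledast G_2$ has vertex set $V_1 \times V_2$, with $(u_1,v_1)$ adjacent to $(u_2,v_2)$ iff $u_1u_2 \in E_1$ and $v_1v_2 \in E_2$. -}

module Defs where

open import Data.Nat using (ℕ; _+_; _*_)
open import Data.Bool using (Bool; true; false; _∧_)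
open import Data.Fin using (Fin; remQuot)
open import Data.Product using (_×_; _,_; proj₁; proj₂)
open import Data.List using (List; map)
open import Data.Nat.ListAction using (sum)
open import Data.List using () renaming (allFin to allFinL)
open import Relation.Binary.PropositionalEquality using (_≡_)

-- A finite simple graph on the vertex set Fin n, given by a Boolean
-- adjacency relation that is symmetric and irreflexive (no loops, no
-- multiple edges since adjacency is a relation).
record Graph : Set where
  field
    n     : ℕ
    adj   : Fin n → Fin n → Bool
    sym   : ∀ u v → adj u v ≡ adj v u
    irrefl : ∀ v → adj v v ≡ false
open Graph public

ΣFin : (k : ℕ) → (Fin k → ℕ) → ℕ
ΣFin k f = sum (map f (allFinL k))

[_] : Bool → ℕ
[ true ]  = 1
[ false ] = 0

deg : (G : Graph) → Fin (n G) → ℕ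
deg G v = ΣFin (n G) (λ u → [ adj G v u ])

δ : (G : Graph) → Fin (n G) → ℕ
δ G v = ΣFin (n G) (λ u → [ adj G v u ] * deg G u)

MN : Graph → ℕ
MN G = ΣFin (n G) (λ v → δ G v * δ G v)

-- Tensor product: vertex set V1 × V2, encoded as Fin (n1 * n2) via the
-- standard bijection remQuot/combine; (u1,v1) ~ (u2,v2) iff u1u2 ∈ E1 and v1v2 ∈ E2.
tensor : Graph → Graph → Graph
tensor G H = record
  { n      = n G * n H
  ; adj    = λ x y → adj G (proj₁ (p x)) (proj₁ (p y)) ∧ adj H (proj₂ (p x)) (proj₂ (p y))
  ; sym    = λ x y → symProof x y
  ; irrefl = λ x → irr x
  }
  where
    p : Fin (n G * n H) → Fin (n G) × Fin (n H)
    p = remQuot (n H)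
    symProof : ∀ x y → (adj G (proj₁ (p x)) (proj₁ (p y)) ∧ adj H (proj₂ (p x)) (proj₂ (p y)))
                     ≡ (adj G (proj₁ (p y)) (proj₁ (p x)) ∧ adj H (proj₂ (p y)) (proj₂ (p x)))
    symProof x y rewrite Graph.sym G (proj₁ (p x)) (proj₁ (p y)) | Graph.sym H (proj₂ (p x)) (proj₂ (p y)) = _≡_.refl
    irr : ∀ x → (adj G (proj₁ (p x)) (proj₁ (p x)) ∧ adj H (proj₂ (p x)) (proj₂ (p x))) ≡ false
    irr x rewrite irrefl G (proj₁ (p x)) = _≡_.refl

_⊛_ : Graph → Graph → Graph
_⊛_ = tensor

module Submission where

-- Identify the vertex set of G₁ ⊛ G₂ with V₁ × V₂ through the
-- bijection combine : Fin m × Fin k → Fin (m * k).  A sum over V₁ × V₂ of a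
-- "separable" summand f(u,v) = a(u) · b(v) factorises as (Σ a) · (Σ b).
-- Since adjacency in the tensor product is the conjunction of adjacencies,
-- its indicator is separable, so
--   deg_{G₁⊛G₂}(u,v) = deg_{G₁}(u) · deg_{G₂}(v),
-- which makes the summand of δ separable, so
--   δ_{G₁⊛G₂}(u,v) = δ_{G₁}(u) · δ_{G₂}(v),
-- and finally δ² is separable, giving M_N(G₁ ⊛ G₂) = M_N(G₁) · M_N(G₂).

open import Defs hiding (sym)
open import Data.Nat using (ℕ; zero; suc; _+_; _*_)
open import Data.Nat.Properties using (+-assoc; +-*-semiring; [m*n]*[o*p]≡[m*o]*[n*p])
open import Data.Nat.ListAction using (sum)
open import Data.Bool using (true; false; _∧_)
open import Data.Fin using (Fin; combine; _↑ˡ_; _↑ʳ_)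
open import Data.Fin.Properties using (remQuot-combine)
open import Data.List using (map; tabulate)
open import Data.List.Properties using (map-tabulate)
open import Data.Product using (proj₁; proj₂)
open import Function using (_∘_)
open import Relation.Binary.PropositionalEquality
  using (_≡_; refl; sym; trans; cong; cong₂; module ≡-Reasoning)
open import Algebra.Properties.Semiring.Sum +-*-semiring
  using (sum-syntax; sum-cong-≗; *-distribˡ-sum; *-distribʳ-sum)
  renaming (sum to ∑)
open ≡-Reasoning

-- The list-based vertex sum ΣFin of the definitions is the library's
-- finite sum ∑ over Fin, whose algebraic laws we then use.
sum-tabulate : ∀ k (f : Fin k → ℕ) → sum (tabulate f) ≡ ∑ f
sum-tabulate zero    f = refl
sum-tabulate (suc k) f = cong (f Fin.zero +_) (sum-tabulate k (f ∘ Fin.suc))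

ΣFin≡∑ : ∀ k (f : Fin k → ℕ) → ΣFin k f ≡ ∑ f
ΣFin≡∑ k f = trans (cong sum (map-tabulate (λ i → i) f)) (sum-tabulate k f)

∑-split : ∀ m n (f : Fin (m + n) → ℕ) →
          ∑ f ≡ ∑[ i < m ] f (i ↑ˡ n) + ∑[ j < n ] f (m ↑ʳ j)
∑-split zero    n f = refl
∑-split (suc m) n f = begin
  f Fin.zero + ∑ (f ∘ Fin.suc)
    ≡⟨ cong (f Fin.zero +_) (∑-split m n (f ∘ Fin.suc)) ⟩
  f Fin.zero + (∑[ i < m ] f (Fin.suc (i ↑ˡ n)) + ∑[ j < n ] f (suc m ↑ʳ j))
    ≡⟨ sym (+-assoc (f Fin.zero) _ _) ⟩
  f Fin.zero + ∑[ i < m ] f (Fin.suc (i ↑ˡ n)) + ∑[ j < n ] f (suc m ↑ʳ j) ∎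

∑-combine : ∀ m n (f : Fin (m * n) → ℕ) →
            ∑ f ≡ ∑[ i < m ] ∑[ j < n ] f (combine i j)
∑-combine zero    n f = refl
∑-combine (suc m) n f =
  trans (∑-split n (m * n) f)
        (cong (∑[ j < n ] f (j ↑ˡ (m * n)) +_) (∑-combine m n (f ∘ (n ↑ʳ_))))

∑-product : ∀ m n (a : Fin m → ℕ) (b : Fin n → ℕ) →
            ∑[ i < m ] ∑[ j < n ] (a i * b j) ≡ ∑ a * ∑ b
∑-product m n a b = begin
  ∑[ i < m ] ∑[ j < n ] (a i * b j)  ≡⟨ sum-cong-≗ (λ i → sym (*-distribˡ-sum (a i) b)) ⟩
  ∑[ i < m ] (a i * ∑ b)             ≡⟨ sym (*-distribʳ-sum (∑ b) a) ⟩
  ∑ a * ∑ b                          ∎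

ΣFin-separable : ∀ m n (f : Fin (m * n) → ℕ) (a : Fin m → ℕ) (b : Fin n → ℕ) →
                 (∀ i j → f (combine i j) ≡ a i * b j) →
                 ΣFin (m * n) f ≡ ΣFin m a * ΣFin n b
ΣFin-separable m n f a b separable = begin
  ΣFin (m * n) f                        ≡⟨ ΣFin≡∑ (m * n) f ⟩
  ∑ f                                   ≡⟨ ∑-combine m n f ⟩
  ∑[ i < m ] ∑[ j < n ] f (combine i j) ≡⟨ sum-cong-≗ (λ i → sum-cong-≗ (separable i)) ⟩
  ∑[ i < m ] ∑[ j < n ] (a i * b j)     ≡⟨ ∑-product m n a b ⟩
  ∑ a * ∑ b                             ≡⟨ sym (cong₂ _*_ (ΣFin≡∑ m a) (ΣFin≡∑ n b)) ⟩
  ΣFin m a * ΣFin n b                   ∎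

[∧] : ∀ p q → [ p ∧ q ] ≡ [ p ] * [ q ]
[∧] false q     = refl
[∧] true  false = refl
[∧] true  true  = refl

module _ (G H : Graph) where

  -- Adjacency in G ⊛ H, read on pairs: combine undoes remQuot.
  adj-⊛ : ∀ u v u′ v′ →
          adj (G ⊛ H) (combine u v) (combine u′ v′) ≡ (adj G u u′ ∧ adj H v v′)
  adj-⊛ u v u′ v′ =
    cong₂ (λ x y → adj G (proj₁ x) (proj₁ y) ∧ adj H (proj₂ x) (proj₂ y))
          (remQuot-combine u v) (remQuot-combine u′ v′)

  [adj-⊛] : ∀ u v u′ v′ →
            [ adj (G ⊛ H) (combine u v) (combine u′ v′) ] ≡ [ adj G u u′ ] * [ adj H v v′ ]
  [adj-⊛] u v u′ v′ = trans (cong [_] (adj-⊛ u v u′ v′)) ([∧] (adj G u u′) (adj H v v′))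

  deg-⊛ : ∀ u v → deg (G ⊛ H) (combine u v) ≡ deg G u * deg H v
  deg-⊛ u v = ΣFin-separable (n G) (n H) _ _ _ ([adj-⊛] u v)

  -- δ_{G⊛H}(u,v) = δ_G(u) · δ_H(v): the summand [u ~ u′][v ~ v′] · deg(u′,v′)
  -- regroups as ([u ~ u′] · deg u′) · ([v ~ v′] · deg v′).
  δ-⊛ : ∀ u v → δ (G ⊛ H) (combine u v) ≡ δ G u * δ H v
  δ-⊛ u v = ΣFin-separable (n G) (n H) _ _ _ summand
    where
    summand : ∀ u′ v′ →
              [ adj (G ⊛ H) (combine u v) (combine u′ v′) ] * deg (G ⊛ H) (combine u′ v′)
              ≡ ([ adj G u u′ ] * deg G u′) * ([ adj H v v′ ] * deg H v′)
    summand u′ v′ = trans (cong₂ _*_ ([adj-⊛] u v u′ v′) (deg-⊛ u′ v′))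
                          ([m*n]*[o*p]≡[m*o]*[n*p] [ adj G u u′ ] [ adj H v v′ ] (deg G u′) (deg H v′))

proposition3 : (G₁ G₂ : Graph) → MN (G₁ ⊛ G₂) ≡ MN G₁ * MN G₂
proposition3 G₁ G₂ = ΣFin-separable (n G₁) (n G₂) _ _ _ δ²-⊛
  where
  δ²-⊛ : ∀ u v → δ (G₁ ⊛ G₂) (combine u v) * δ (G₁ ⊛ G₂) (combine u v)
                 ≡ (δ G₁ u * δ G₁ u) * (δ G₂ v * δ G₂ v)
  δ²-⊛ u v = trans (cong₂ _*_ (δ-⊛ G₁ G₂ u v) (δ-⊛ G₁ G₂ u v))
                   ([m*n]*[o*p]≡[m*o]*[n*p] (δ G₁ u) (δ G₂ v) (δ G₁ u) (δ G₂ v))
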